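{- Let $\alpha$ be a countable order type and $S$ a sierpinskisation of $\alpha$ and $\omega$. If $S$ can be embedded in $[\omega]^{<\omega}$ as a join-semilattice (i.e. $S$ is order-isomorphic to a join-subsemilattice of $[\omega]^{<\omega}$), then $\alpha$ is an ordinal.
   Context: A sierpinskisation of a countable order type $\alpha$ and $\omega$ is a poset $(S,\le)$ whose order is the intersection of two linear orders on $S$, one of type $\alpha$ and the other of type $\omega$. $[\omega]^{<\omega}$ is the set of finite subsets of $\omega$ ordered by inclusion (join = union); a join-subsemilattice is a subset closed under unions of two elements. -}

module Defs where

open import Level using (Level; _⊔_) renaming (suc to lsuc)
open import Data.Nat using (ℕ; _≤_)
open import Data.Bool using (Bool; true; false; _∨_)
open import Data.Product using (_×_; Σ; proj₁; ∃; ∃-syntax)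
open import Relation.Binary.PropositionalEquality using (_≡_)
open import Relation.Binary.Structures using (IsTotalOrder)
open import Relation.Binary.Core using (Rel)
open import Relation.Nullary using (¬_)
open import Function.Bundles using (_⇔_; _⤖_; Bijection)
open import Induction.WellFounded using (WellFounded)

-- [ω]^{<ω}: finite subsets of ℕ, as characteristic functions with
-- finite support.

FinSubset : Set
FinSubset = Σ (ℕ → Bool) λ f → ∃[ n ] (∀ m → n ≤ m → f m ≡ false)

_∈ₛ_ : ℕ → FinSubset → Set
m ∈ₛ A = proj₁ A m ≡ true

_⊆ₛ_ : FinSubset → FinSubset → Set
A ⊆ₛ B = ∀ m → m ∈ₛ A → m ∈ₛ B

IsUnion : FinSubset → FinSubset → FinSubset → Set
IsUnion A B C = ∀ m → proj₁ C m ≡ (proj₁ A m ∨ proj₁ B m)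

IsOrderIso : ∀ {a b ℓ₁ ℓ₂} {X : Set a} {Y : Set b} →
             Rel X ℓ₁ → Rel Y ℓ₂ → X ⤖ Y → Set (a ⊔ ℓ₁ ⊔ ℓ₂)
IsOrderIso _≤X_ _≤Y_ f = ∀ x y → (x ≤X y) ⇔ (Bijection.to f x ≤Y Bijection.to f y)

-- A sierpinskisation of α and ω on the carrier S.
-- α is a countable order type, given by a linear order (A, ≤α);
-- S carries two linear orders, ≤₁ of type α and ≤₂ of type ω;
-- the poset order ⊑ of S is their intersection.
-- (Countability of α is automatic: A ≅ S ≅ ℕ.)

record Sierpinskisation {a ℓ : Level} (A : Set a) (_≤α_ : Rel A ℓ)
                        (S : Set a) : Set (lsuc (a ⊔ ℓ)) where
  field
    _≤₁_ : Rel S ℓ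
    _≤₂_ : Rel S ℓ
    ≤₁-linear : IsTotalOrder _≡_ _≤₁_
    ≤₂-linear : IsTotalOrder _≡_ _≤₂_
    isoα : S ⤖ A
    isoα-order : IsOrderIso _≤₁_ _≤α_ isoα
    isoω : S ⤖ ℕ
    isoω-order : IsOrderIso _≤₂_ _≤_ isoω

  _⊑_ : Rel S ℓ
  x ⊑ y = (x ≤₁ y) × (x ≤₂ y)

record JoinEmbedding {a ℓ : Level} {A : Set a} {_≤α_ : Rel A ℓ} {S : Set a}
                     (σ : Sierpinskisation A _≤α_ S) : Set (a ⊔ ℓ) where
  open Sierpinskisation σ
  field
    emb       : S → FinSubset
    emb-order : ∀ x y → (x ⊑ y) ⇔ (emb x ⊆ₛ emb y)
    emb-join  : ∀ x y → ∃[ z ] IsUnion (emb x) (emb y) (emb z)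

IsOrdinal : ∀ {a ℓ} {A : Set a} → Rel A ℓ → Set (a ⊔ ℓ)
IsOrdinal {A = A} _≤α_ = WellFounded (λ (u v : A) → (u ≤α v) × ¬ (u ≡ v))

-- Fix x in S and let N bound the support of the set coding x. Colour every
-- element z by its code restricted to {0, …, N-1}; there are at most 2^N
-- colours. If v <₁ y ≤₁ x had the same colour but pos y ≤ pos v in the
-- ω-order, then y ⊑ x ∨ v; as x contributes nothing from N on and y, v
-- agree below N, y's code is included in v's, so y ⊑ v, contradicting
-- v <₁ y. Hence along a ≤₁-descending sequence below x the ω-position
-- strictly decreases within each of finitely many colour classes, and the
-- sequence is finite.
module Submission where

open import Defs
open import Level using (Level; _⊔_; 0ℓ)
open import Relation.Binary.Core using (Rel)
open import Relation.Binary.PropositionalEquality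
  using (_≡_; refl; sym; trans; cong; subst; subst₂; module ≡-Reasoning)
open import Relation.Binary.Structures using (IsTotalOrder)

open import Data.Bool using (Bool; true; false; _∨_)
open import Data.Bool.Properties using (∨-zeroʳ) renaming (_≟_ to _≟ᵇ_)
open import Data.List using (List; []; _∷_; _++_; map; applyUpTo)
open import Data.List.Properties using (∷-injective; map-cong; ≡-dec)
open import Data.List.Membership.Propositional using (_∈_)
open import Data.List.Membership.Propositional.Properties using (∈-map⁺; ∈-++⁺ˡ; ∈-++⁺ʳ)
open import Data.List.Relation.Unary.Any using (here; there)
open import Data.Maybe using (Maybe; just; nothing; fromMaybe)
open import Data.Maybe.Relation.Unary.All using (All; just; nothing)
open import Data.Nat using (ℕ; zero; suc; _≤_; _<_; z≤n; s≤s)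
open import Data.Nat.ListAction using (sum)
open import Data.Nat.Induction using (<-wellFounded)
open import Data.Nat.Properties using (≤-refl; <⇒≤; +-mono-≤; +-mono-<-≤; +-mono-≤-<; _<?_; ≮⇒≥)
open import Data.Product using (_×_; _,_; proj₁; proj₂)
open import Data.Product.Relation.Binary.Lex.Strict using (×-Lex; ×-wellFounded)
open import Data.Sum using (inj₁; inj₂)
open import Function using (_∘_; _on_)
open import Function.Bundles using (_⤖_; Bijection; Surjection; Equivalence)
open import Induction.WellFounded using (WellFounded; Acc; acc; module Subrelation)
open import Relation.Binary.Definitions using (Transitive; Reflexive; DecidableEquality)
open import Relation.Binary.Construct.Closure.Reflexive using (ReflClosure; refl; [_])
import Relation.Binary.Construct.NonStrictToStrict as NonStrictToStrict
import Relation.Binary.Construct.On as On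
open import Relation.Nullary using (yes; no; contradiction)

sum-map-mono : ∀ {A : Set} {f g : A → ℕ} →
               (∀ a → f a ≤ g a) → ∀ l → sum (map f l) ≤ sum (map g l)
sum-map-mono f≤g []      = z≤n
sum-map-mono f≤g (a ∷ l) = +-mono-≤ (f≤g a) (sum-map-mono f≤g l)

sum-map-strict : ∀ {A : Set} {f g : A → ℕ} → (∀ a → f a ≤ g a) →
                 ∀ {a l} → a ∈ l → f a < g a → sum (map f l) < sum (map g l)
sum-map-strict f≤g {l = _ ∷ l} (here refl) fa<ga = +-mono-<-≤ fa<ga (sum-map-mono f≤g l)
sum-map-strict f≤g {l = b ∷ _} (there a∈l) fa<ga = +-mono-≤-< (f≤g b) (sum-map-strict f≤g a∈l fa<ga)

bitLists : ℕ → List (List Bool)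
bitLists zero    = [] ∷ []
bitLists (suc n) = map (true ∷_) (bitLists n) ++ map (false ∷_) (bitLists n)

applyUpTo-∈-bitLists : ∀ (f : ℕ → Bool) n → applyUpTo f n ∈ bitLists n
applyUpTo-∈-bitLists f zero = here refl
applyUpTo-∈-bitLists f (suc n) with f 0
... | true  = ∈-++⁺ˡ (∈-map⁺ (true ∷_) (applyUpTo-∈-bitLists (f ∘ suc) n))
... | false = ∈-++⁺ʳ (map (true ∷_) (bitLists n))
                     (∈-map⁺ (false ∷_) (applyUpTo-∈-bitLists (f ∘ suc) n))

applyUpTo-injective-below : ∀ {A : Set} {f g : ℕ → A} n →
                            applyUpTo f n ≡ applyUpTo g n → ∀ {m} → m < n → f m ≡ g m
applyUpTo-injective-below (suc n) eq {zero}  _         = proj₁ (∷-injective eq)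
applyUpTo-injective-below (suc n) eq {suc m} (s≤s m<n) =
  applyUpTo-injective-below n (proj₂ (∷-injective eq)) m<n

module FinitelyColoured
  {a ℓ} {X : Set a} {_≺_ : Rel X ℓ} (≺-trans : Transitive _≺_)
  {C : Set} (_≟_ : DecidableEquality C) (colour : X → C)
  (palette : List C) (colour∈palette : ∀ z → colour z ∈ palette)
  (height : X → ℕ) (top : X)
  (height-mono : ∀ {w y} → w ≺ y → ReflClosure _≺_ y top →
                 colour w ≡ colour y → height w < height y)
  where

  _≼_ : Rel X (a ⊔ ℓ)
  _≼_ = ReflClosure _≺_

  ≼-≺-trans : ∀ {u w y} → u ≼ w → w ≺ y → u ≺ y
  ≼-≺-trans refl     w≺y = w≺y
  ≼-≺-trans [ u≺w ] w≺y = ≺-trans u≺w w≺y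

  ≺-≼-trans : ∀ {w y z} → w ≺ y → y ≼ z → w ≺ z
  ≺-≼-trans w≺y refl     = w≺y
  ≺-≼-trans w≺y [ y≺z ] = ≺-trans w≺y y≺z

  -- A record stores, for each colour, a strict upper bound on the heights
  -- of that colour met so far; nothing means no bound yet.
  Record : Set
  Record = C → Maybe ℕ

  Bounds : Record → X → Set (a ⊔ ℓ)
  Bounds r y = ∀ v → v ≼ y → All (height v <_) (r (colour v))

  note : Record → X → Record
  note r y c with c ≟ colour y
  ... | yes _ = just (height y)
  ... | no  _ = r c

  note-at : ∀ r y → note r y (colour y) ≡ just (height y)
  note-at r y with colour y ≟ colour y
  ... | yes _ = refl
  ... | no ne = contradiction refl ne

  note-pointwise : (_∼_ : Rel ℕ 0ℓ) → Reflexive _∼_ → (F : Maybe ℕ → ℕ) →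
                   ∀ r y → F (just (height y)) ∼ F (r (colour y)) →
                   ∀ c → F (note r y c) ∼ F (r c)
  note-pointwise _∼_ ∼-refl F r y hy c with c ≟ colour y
  ... | yes refl = hy
  ... | no  _    = ∼-refl

  note-bounds : ∀ {r y w} → y ≼ top → Bounds r y → w ≺ y → Bounds (note r y) w
  note-bounds {y = y} y≼top bnd w≺y v v≼w with colour v ≟ colour y
  ... | yes same = just (height-mono (≼-≺-trans v≼w w≺y) y≼top same)
  ... | no  _    = bnd v [ ≼-≺-trans v≼w w≺y ]

  unseen : Maybe ℕ → ℕ
  unseen nothing  = 1
  unseen (just _) = 0

  sumOver : (Maybe ℕ → ℕ) → Record → ℕ
  sumOver F r = sum (map (F ∘ r) palette)

  sumOver-note-≡ : ∀ F {r y b} → r (colour y) ≡ b → F (just (height y)) ≡ F b →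
                   sumOver F (note r y) ≡ sumOver F r
  sumOver-note-≡ F {r} {y} refl eq = cong sum (map-cong (note-pointwise _≡_ refl F r y eq) palette)

  sumOver-note-< : ∀ F {r y b} → r (colour y) ≡ b → F (just (height y)) < F b →
                   sumOver F (note r y) < sumOver F r
  sumOver-note-< F {r} {y} refl lt =
    sum-map-strict (note-pointwise _≤_ ≤-refl F r y (<⇒≤ lt)) (colour∈palette y)
                   (subst (λ b → F b < F (r (colour y))) (sym (note-at r y)) lt)

  weight : Record → ℕ × ℕ
  weight r = sumOver unseen r , sumOver (fromMaybe 0) r

  _⊏_ : Rel Record 0ℓ
  _⊏_ = ×-Lex _≡_ _<_ _<_ on weight

  ⊏-wellFounded : WellFounded _⊏_
  ⊏-wellFounded = On.wellFounded weight (×-wellFounded <-wellFounded <-wellFounded)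

  -- A new colour lowers the number of unbounded colours; an old one keeps it
  -- and lowers that colour's bound, hence the sum of the bounds.
  note-⊏ : ∀ {r y} → Bounds r y → note r y ⊏ r
  note-⊏ {r} {y} bnd with r (colour y) in eq | bnd y refl
  ... | nothing | _          = inj₁ (sumOver-note-< unseen eq (s≤s z≤n))
  ... | just m  | just hy<m = inj₂ (sumOver-note-≡ unseen eq refl , sumOver-note-< (fromMaybe 0) eq hy<m)

  acc-bounded : ∀ {r} → Acc _⊏_ r → ∀ {y} → y ≼ top → Bounds r y → Acc _≺_ y
  acc-bounded (acc rec) y≼top bnd =
    acc λ w≺y → acc-bounded (rec (note-⊏ bnd)) [ ≺-≼-trans w≺y y≼top ] (note-bounds y≼top bnd w≺y)

  acc-top : Acc _≺_ top
  acc-top = acc-bounded (⊏-wellFounded (λ _ → nothing)) refl (λ _ _ → nothing)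

module _ {a b ℓ₁ ℓ₂} {X : Set a} {Y : Set b} {_≤X_ : Rel X ℓ₁} {_≤Y_ : Rel Y ℓ₂}
         (f : X ⤖ Y) (f-order : IsOrderIso _≤X_ _≤Y_ f) where
  open NonStrictToStrict _≡_ _≤X_ using () renaming (_<_ to _<X_)
  open NonStrictToStrict _≡_ _≤Y_ using () renaming (_<_ to _<Y_)
  open Bijection f using (to; surjection)
  open Surjection surjection using (to⁻; to∘to⁻)

  strict-wellFounded-⤖ : WellFounded _<X_ → WellFounded _<Y_
  strict-wellFounded-⤖ wf = Subrelation.wellFounded to⁻-strict (On.wellFounded to⁻ wf)
    where
    to⁻-strict : ∀ {u v} → u <Y v → to⁻ u <X to⁻ v
    to⁻-strict {u} {v} (u≤v , u≢v) =
        Equivalence.from (f-order (to⁻ u) (to⁻ v)) (subst₂ _≤Y_ (sym (to∘to⁻ u)) (sym (to∘to⁻ v)) u≤v)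
      , λ eq → u≢v (trans (sym (to∘to⁻ u)) (trans (cong to eq) (to∘to⁻ v)))

bound : FinSubset → ℕ
bound = proj₁ ∘ proj₂

IsUnion⇒⊆ˡ : ∀ {A B C} → IsUnion A B C → A ⊆ₛ C
IsUnion⇒⊆ˡ {B = B} u m m∈A = trans (u m) (cong (_∨ proj₁ B m) m∈A)

IsUnion⇒⊆ʳ : ∀ {A B C} → IsUnion A B C → B ⊆ₛ C
IsUnion⇒⊆ʳ {A} u m m∈B = trans (u m) (trans (cong (proj₁ A m ∨_) m∈B) (∨-zeroʳ (proj₁ A m)))

IsUnion-⊆-cancelˡ : ∀ {A B C D} → IsUnion A B C → D ⊆ₛ C →
                    (∀ {m} → m < bound A → m ∈ₛ D → m ∈ₛ B) → D ⊆ₛ B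
IsUnion-⊆-cancelˡ {A} {B} {C} u D⊆C below m m∈D with m <? bound A
... | yes m<N = below m<N m∈D
... | no  m≮N = begin
  proj₁ B m                ≡⟨ cong (_∨ proj₁ B m) (sym (proj₂ (proj₂ A) m (≮⇒≥ m≮N))) ⟩
  proj₁ A m ∨ proj₁ B m    ≡⟨ sym (u m) ⟩
  proj₁ C m                ≡⟨ D⊆C m m∈D ⟩
  true                     ∎
  where open ≡-Reasoning

module _ {a ℓ} {A : Set a} {_≤α_ : Rel A ℓ} {S : Set a}
         (σ : Sierpinskisation A _≤α_ S) (ι : JoinEmbedding σ) where
  open Sierpinskisation σ
  open JoinEmbedding ι
  module ≤₁ = IsTotalOrder ≤₁-linear
  module ≤₂ = IsTotalOrder ≤₂-linear
  open NonStrictToStrict _≡_ _≤₁_ using (<-trans) renaming (_<_ to _<₁_)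

  pos : S → ℕ
  pos = Bijection.to isoω

  trace : S → S → List Bool
  trace x z = applyUpTo (proj₁ (emb z)) (bound (emb x))

  ⊑-join : ∀ {x y v j} → y ≤₁ x → y ≤₂ v → IsUnion (emb x) (emb v) (emb j) → y ⊑ j
  ⊑-join {x} {y} {v} {j} y≤x y≤v u = ≤₁.trans y≤x (proj₁ x⊑j) , ≤₂.trans y≤v (proj₂ v⊑j)
    where
    x⊑j : x ⊑ j
    x⊑j = Equivalence.from (emb-order x j) (IsUnion⇒⊆ˡ {emb x} {emb v} {emb j} u)
    v⊑j : v ⊑ j
    v⊑j = Equivalence.from (emb-order v j) (IsUnion⇒⊆ʳ {emb x} {emb v} {emb j} u)

  ⊑-of-same-trace : ∀ {x y v} → y ≤₁ x → y ≤₂ v → trace x y ≡ trace x v → y ⊑ v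
  ⊑-of-same-trace {x} {y} {v} y≤x y≤v same with emb-join x v
  ... | j , u = Equivalence.from (emb-order y v)
          (IsUnion-⊆-cancelˡ {emb x} {emb v} {emb j} {emb y} u
            (Equivalence.to (emb-order y j) (⊑-join y≤x y≤v u))
            (λ m<N m∈y → trans (sym (applyUpTo-injective-below (bound (emb x)) same m<N)) m∈y))

  pos-mono-on-trace : ∀ {x v y} → v <₁ y → y ≤₁ x → trace x v ≡ trace x y → pos v < pos y
  pos-mono-on-trace {x} {v} {y} (v≤y , v≢y) y≤x same with pos v <? pos y
  ... | yes pv<py = pv<py
  ... | no  pv≮py = contradiction (≤₁.antisym v≤y (proj₁ y⊑v)) v≢y
    where
    y⊑v : y ⊑ v
    y⊑v = ⊑-of-same-trace y≤x (Equivalence.from (isoω-order y v) (≮⇒≥ pv≮py)) (sym same)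

  ≼⇒≤₁ : ∀ {y x} → ReflClosure _<₁_ y x → y ≤₁ x
  ≼⇒≤₁ refl        = ≤₁.refl
  ≼⇒≤₁ [ y≤x , _ ] = y≤x

  <₁-wellFounded : WellFounded _<₁_
  <₁-wellFounded x = FinitelyColoured.acc-top (<-trans ≤₁.isPartialOrder) (≡-dec _≟ᵇ_) (trace x)
    (bitLists (bound (emb x))) (λ z → applyUpTo-∈-bitLists (proj₁ (emb z)) (bound (emb x)))
    pos x (λ v<y y≼x → pos-mono-on-trace v<y (≼⇒≤₁ y≼x))

corollary2p4 : ∀ {a ℓ : Level} (A : Set a) (_≤α_ : Rel A ℓ) →
    IsTotalOrder _≡_ _≤α_ →
    (S : Set a) (σ : Sierpinskisation A _≤α_ S) →
    JoinEmbedding σ →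
    IsOrdinal _≤α_
corollary2p4 A _≤α_ _ S σ ι =
  strict-wellFounded-⤖ (Sierpinskisation.isoα σ) (Sierpinskisation.isoα-order σ) (<₁-wellFounded σ ι)
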